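{- Let $k\geq 1$ and let $\mathcal{H}$ be an $r$-uniform hypergraph on $[n]$. For any $i,j\in[n]$ with $i<j$, we have $$N\big(S_{r-1,k}^r,S_{ij}(\mathcal{H})\big)\geq N\big(S_{r-1,k}^r,\mathcal{H}\big).$$
   Context: An $r$-uniform hypergraph is identified with its set of hyperedges ($r$-subsets of the vertex set). For $1\le i<j\le n$ and a hyperedge $e$ of $\mathcal{H}$, the shifting operator is defined by $S_{ij}(e)=(e\setminus\{j\})\cup\{i\}$ if $j\in e$, $i\notin e$ and $(e\setminus\{j\})\cup\{i\}\notin \mathcal{H}$, and $S_{ij}(e)=e$ otherwise; $S_{ij}(\mathcal{H})=\{S_{ij}(e):e\in\mathcal{H}\}$. For $r>t\ge0$, $k\ge1$, $S_{t,k}^r$ is the $r$-uniform hypergraph with hyperedges $e_1,\dots,e_k$ such that there is a $t$-set $T$ with $e_a\cap e_b=T$ for all $1\le a<b\le k$ (a single hyperedge when $k=1$). $N(\mathcal{F},\mathcal{G})$ is the number of subhypergraphs of $\mathcal{G}$ isomorphic to $\mathcal{F}$. -}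

module Defs where

open import Data.Bool using (Bool; true; false; _∧_; _∨_; not; if_then_else_)
open import Data.Nat using (ℕ; zero; suc; _∸_; _≡ᵇ_)
open import Data.List using (List; []; _∷_; _++_; map; length)
open import Data.Bool.ListAction using (all; any)
open import Data.Fin using (Fin)
open import Data.Vec using (Vec; []; _∷_; lookup)
import Data.Vec.Properties as VecP
import Data.Bool.Properties as BoolP
open import Data.Fin.Subset using (Subset; inside; outside; _∩_; _∪_; _-_; ⁅_⁆; ∣_∣)
open import Relation.Nullary.Decidable using (⌊_⌋)

_==S_ : {n : ℕ} → Subset n → Subset n → Bool
a ==S b = ⌊ VecP.≡-dec BoolP._≟_ a b ⌋

_∈ᵇ_ : {n : ℕ} → Fin n → Subset n → Bool
x ∈ᵇ e = lookup e x

allSubsets : (n : ℕ) → List (Subset n)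
allSubsets zero = [] ∷ []
allSubsets (suc n) = map (outside ∷_) (allSubsets n) ++ map (inside ∷_) (allSubsets n)

Hypergraph : ℕ → Set
Hypergraph n = Subset n → Bool

Uniform : {n : ℕ} → ℕ → Hypergraph n → Set
Uniform {n} r H = (e : Subset n) → H e ≡ true → ∣ e ∣ ≡ r
  where open import Relation.Binary.PropositionalEquality using (_≡_)

filterᵇ : {A : Set} → (A → Bool) → List A → List A
filterᵇ p [] = []
filterᵇ p (x ∷ xs) = if p x then x ∷ filterᵇ p xs else filterᵇ p xs

edges : {n : ℕ} → Hypergraph n → List (Subset n)
edges {n} H = filterᵇ H (allSubsets n)

shiftEdge : {n : ℕ} → Hypergraph n → Fin n → Fin n → Subset n → Subset n
shiftEdge H i j e =
  if (j ∈ᵇ e) ∧ not (i ∈ᵇ e) ∧ not (H ((e - j) ∪ ⁅ i ⁆))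
  then (e - j) ∪ ⁅ i ⁆
  else e

shift : {n : ℕ} → Fin n → Fin n → Hypergraph n → Hypergraph n
shift {n} i j H f = any (λ e → H e ∧ (shiftEdge H i j e ==S f)) (allSubsets n)

-- All sublists (subsequences) of a list; for a duplicate-free list these
-- are exactly its subsets, each listed once.
sublists : {A : Set} → List A → List (List A)
sublists [] = [] ∷ []
sublists (x ∷ xs) = sublists xs ++ map (x ∷_) (sublists xs)

pairwiseᵇ : {A : Set} → (A → A → Bool) → List A → Bool
pairwiseᵇ p [] = true
pairwiseᵇ p (x ∷ xs) = all (p x) xs ∧ pairwiseᵇ p xs

-- A family of hyperedges e_1..e_k forms a copy of S^r_{t,k}: there is a
-- t-set T with e_a ∩ e_b = T for all a < b.
isSunflower : {n : ℕ} → ℕ → List (Subset n) → Bool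
isSunflower {n} t F =
  any (λ T → (∣ T ∣ ≡ᵇ t) ∧ pairwiseᵇ (λ a b → (a ∩ b) ==S T) F) (allSubsets n)

-- N(S^r_{t,k}, G): number of k-sets of hyperedges of G forming S^r_{t,k}.
-- (Uniformity r of G is assumed separately.)
N-S : {n : ℕ} → (t k : ℕ) → Hypergraph n → ℕ
N-S t k G =
  length (filterᵇ (λ F → (length F ≡ᵇ k) ∧ isSunflower t F) (sublists (edges G)))

-- Map every counted copy F of S^r_{r-1,k} in H to one in S_ij(H), and check that the map is
-- injective. If all petals of F survive the shift, F itself is counted in S_ij(H). Otherwise some
-- petal e₀ was moved: j ∈ e₀, i ∉ e₀ and σ e₀ ∉ H, where σ exchanges the vertices i and j. Then
-- σ e lies in S_ij(H) for every petal e: this could only fail if i ∈ e, j ∉ e and σ e ∉ H, but two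
-- r-sets meeting in r - 1 vertices each have exactly one vertex outside the other, so then
-- σ e = e₀ ∈ H. As σ preserves sizes and intersections, σF is again a copy of S^r_{r-1,k}.
-- Distinct F give distinct images: σ is injective, and σF contains σ e₀ ∉ H, so it never equals
-- an unmoved family, all of whose petals lie in H.
module Submission where

open import Defs
open import Data.Bool using (Bool; true; false; T; not; _∧_; _∨_; if_then_else_)
import Data.Bool.Properties as Bool
open import Data.Bool.Properties
  using (T?; T-∧; T-≡; ¬-not; ∧-zeroʳ; ∧-identityʳ; ∨-zeroʳ; ∨-identityʳ)
open import Data.Nat using (ℕ; zero; suc; _≤_; _≥_; _∸_; _+_; z≤n; s≤s; _≡ᵇ_)
import Data.Nat.Properties as ℕ
open import Data.List using (List; []; _∷_; _++_; map; length; filter)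
open import Data.List.Properties using (length-map; ∷-injectiveʳ)
open import Data.List.Membership.Propositional using (_∈_; _∉_; find; lose)
open import Data.List.Membership.Propositional.Properties
  using (∈-∃++; ∈-++⁻; ∈-++⁺ˡ; ∈-++⁺ʳ; ∈-map⁺; ∈-map⁻; ∈-filter⁺; ∈-filter⁻)
open import Data.List.Relation.Binary.Subset.Propositional using (_⊆_)
open import Data.List.Relation.Binary.Sublist.Propositional
  using ([]; _∷_; _∷ʳ_) renaming (_⊆_ to _⊑_)
open import Data.List.Relation.Binary.Sublist.Propositional.Properties
  using (Any-resp-⊆; All-resp-⊆; filter-⊆)
open import Data.List.Relation.Unary.All using (All; []; _∷_; all?)
import Data.List.Relation.Unary.All as All
open import Data.List.Relation.Unary.All.Properties using (all⁺; all⁻; ¬All⇒Any¬; map⁺)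
open import Data.List.Relation.Unary.Any using (here; there; satisfied)
open import Data.List.Relation.Unary.Any.Properties using (any⁺; any⁻)
open import Data.List.Relation.Unary.Unique.Propositional using (Unique; []; _∷_)
open import Data.List.Relation.Unary.Unique.Propositional.Properties
  using (Unique[x∷xs]⇒x∉xs; ++⁺) renaming (filter⁺ to Unique-filter⁺)
open import Data.Fin using (Fin; zero; suc; _<_; _≟_)
open import Data.Fin.Properties using (<⇒≢)
open import Data.Fin.Subset using (Subset; ∣_∣; _∩_; _∪_; _─_; _-_; ⁅_⁆)
import Data.Fin.Subset as Sub
open import Data.Fin.Subset.Properties
  using (∩-comm; p⊆q⇒∣p∣≤∣q∣; x∈p∩q⁻; x∈p∧x≢y⇒x∈p-y; x∈p⇒∣p-x∣<∣p∣; x∈⁅x⁆; x≢y⇒x∉⁅y⁆)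
open import Data.Vec using (Vec; []; _∷_; lookup; _[_]≔_; tabulate)
import Data.Vec.Properties as Vec
open import Relation.Nullary.Decidable using (toWitness; fromWitness)
open import Data.Product using (_×_; _,_; proj₁; proj₂)
open import Data.Sum using (inj₁; inj₂)
open import Function using (_∘_; id; Equivalence)
open import Relation.Binary.PropositionalEquality
open import Level using (_⊔_)
open import Relation.Nullary using (¬_; contradiction; yes; no)
open import Data.Empty using (⊥; ⊥-elim)
import Data.List.Membership.DecPropositional as DecMembership

-- Duplicate-free lists

module _ {a} {A : Set a} where

  ∈-++-∷⁻ : ∀ {x y : A} ys₁ {ys₂} → y ∈ ys₁ ++ x ∷ ys₂ → y ≢ x → y ∈ ys₁ ++ ys₂
  ∈-++-∷⁻ ys₁ y∈ y≢x with ∈-++⁻ ys₁ y∈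
  ... | inj₁ y∈ys₁ = ∈-++⁺ˡ y∈ys₁
  ... | inj₂ (here y≡x) = contradiction y≡x y≢x
  ... | inj₂ (there y∈ys₂) = ∈-++⁺ʳ ys₁ y∈ys₂

  length-++-∷ : ∀ (ys₁ : List A) {x ys₂} → length (ys₁ ++ x ∷ ys₂) ≡ suc (length (ys₁ ++ ys₂))
  length-++-∷ [] = refl
  length-++-∷ (y ∷ ys₁) = cong suc (length-++-∷ ys₁)

  length-mono-⊆ : ∀ {xs ys : List A} → Unique xs → xs ⊆ ys → length xs ≤ length ys
  length-mono-⊆ [] _ = z≤n
  length-mono-⊆ {x ∷ xs} (x∉xs ∷ !xs) xs⊆ys
    with ys₁ , ys₂ , refl ← ∈-∃++ (xs⊆ys (here refl)) = begin
      suc (length xs)           ≤⟨ s≤s (length-mono-⊆ !xs xs⊆ys₁++ys₂) ⟩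
      suc (length (ys₁ ++ ys₂)) ≡⟨ length-++-∷ ys₁ ⟨
      length (ys₁ ++ x ∷ ys₂)   ∎
    where
    open ℕ.≤-Reasoning
    xs⊆ys₁++ys₂ : xs ⊆ ys₁ ++ ys₂
    xs⊆ys₁++ys₂ y∈xs = ∈-++-∷⁻ ys₁ (xs⊆ys (there y∈xs)) (≢-sym (All.lookup x∉xs y∈xs))

  length-cong-⊆⊇ : ∀ {xs ys : List A} → Unique xs → Unique ys → xs ⊆ ys → ys ⊆ xs →
                   length xs ≡ length ys
  length-cong-⊆⊇ !xs !ys xs⊆ys ys⊆xs =
    ℕ.≤-antisym (length-mono-⊆ !xs xs⊆ys) (length-mono-⊆ !ys ys⊆xs)

  Unique-resp-⊑ : ∀ {xs ys : List A} → xs ⊑ ys → Unique ys → Unique xs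
  Unique-resp-⊑ [] [] = []
  Unique-resp-⊑ (y ∷ʳ xs⊑ys) (_ ∷ !ys) = Unique-resp-⊑ xs⊑ys !ys
  Unique-resp-⊑ (refl ∷ xs⊑ys) (y∉ys ∷ !ys) = All-resp-⊆ xs⊑ys y∉ys ∷ Unique-resp-⊑ xs⊑ys !ys

  ⊑-ext : ∀ {xs ys zs : List A} → Unique zs → xs ⊑ zs → ys ⊑ zs → xs ⊆ ys → ys ⊆ xs → xs ≡ ys
  ⊑-ext [] [] [] _ _ = refl
  ⊑-ext (_ ∷ !zs) (z ∷ʳ xs⊑) (.z ∷ʳ ys⊑) xs⊆ys ys⊆xs = ⊑-ext !zs xs⊑ ys⊑ xs⊆ys ys⊆xs
  ⊑-ext !z∷zs (refl ∷ xs⊑) (z ∷ʳ ys⊑) xs⊆ys _ =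
    contradiction (Any-resp-⊆ ys⊑ (xs⊆ys (here refl))) (Unique[x∷xs]⇒x∉xs !z∷zs)
  ⊑-ext !z∷zs (z ∷ʳ xs⊑) (refl ∷ ys⊑) _ ys⊆xs =
    contradiction (Any-resp-⊆ xs⊑ (ys⊆xs (here refl))) (Unique[x∷xs]⇒x∉xs !z∷zs)
  ⊑-ext {zs = z ∷ zs} !z∷zs@(_ ∷ !zs) (refl ∷ xs⊑) (refl ∷ ys⊑) xs⊆ys ys⊆xs =
    cong (z ∷_) (⊑-ext !zs xs⊑ ys⊑ (drop xs⊑ xs⊆ys) (drop ys⊑ ys⊆xs))
    where
    drop : ∀ {us vs} → us ⊑ zs → z ∷ us ⊆ z ∷ vs → us ⊆ vs
    drop us⊑ z∷us⊆ u∈us with z∷us⊆ (there u∈us)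
    ... | here refl = contradiction (Any-resp-⊆ us⊑ u∈us) (Unique[x∷xs]⇒x∉xs !z∷zs)
    ... | there u∈vs = u∈vs

module _ {a b} {A : Set a} {B : Set b} {f : A → B} where

  InjectiveOn : List A → Set (a ⊔ b)
  InjectiveOn xs = ∀ {x y} → x ∈ xs → y ∈ xs → f x ≡ f y → x ≡ y

  Unique-map⁺ : ∀ {xs} → InjectiveOn xs → Unique xs → Unique (map f xs)
  Unique-map⁺ _ [] = []
  Unique-map⁺ inj (x∉xs ∷ !xs) =
    map⁺ (All.tabulate λ y∈xs → All.lookup x∉xs y∈xs ∘ inj (here refl) (there y∈xs))
    ∷ Unique-map⁺ (λ x∈ y∈ → inj (there x∈) (there y∈)) !xs

  length-≤-of-injection : ∀ {xs ys} → Unique xs → InjectiveOn xs → (∀ {x} → x ∈ xs → f x ∈ ys) →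
                          length xs ≤ length ys
  length-≤-of-injection {xs} {ys} !xs inj f∈ys = begin
    length xs         ≡⟨ length-map f xs ⟨
    length (map f xs) ≤⟨ length-mono-⊆ (Unique-map⁺ inj !xs) fxs⊆ys ⟩
    length ys         ∎
    where
    open ℕ.≤-Reasoning
    fxs⊆ys : map f xs ⊆ ys
    fxs⊆ys y∈fxs with x , x∈xs , refl ← ∈-map⁻ f y∈fxs = f∈ys x∈xs

  map-⊆⁻ : ∀ {xs ys} → (∀ {x y} → f x ≡ f y → x ≡ y) → map f xs ⊆ map f ys → xs ⊆ ys
  map-⊆⁻ f-inj fxs⊆fys x∈xs with _ , y∈ys , fx≡fy ← ∈-map⁻ f (fxs⊆fys (∈-map⁺ f x∈xs)) =
    subst (_∈ _) (sym (f-inj fx≡fy)) y∈ys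

module _ {A : Set} where

  ∈-sublists⁻ : ∀ {xs ys : List A} → xs ∈ sublists ys → xs ⊑ ys
  ∈-sublists⁻ {ys = []} (here refl) = []
  ∈-sublists⁻ {ys = y ∷ ys} xs∈ with ∈-++⁻ (sublists ys) xs∈
  ... | inj₁ xs∈ys = y ∷ʳ ∈-sublists⁻ xs∈ys
  ... | inj₂ xs∈y∷ys with _ , zs∈ , refl ← ∈-map⁻ (y ∷_) xs∈y∷ys = refl ∷ ∈-sublists⁻ zs∈

  ∈-sublists⁺ : ∀ {xs ys : List A} → xs ⊑ ys → xs ∈ sublists ys
  ∈-sublists⁺ [] = here refl
  ∈-sublists⁺ (y ∷ʳ xs⊑ys) = ∈-++⁺ˡ (∈-sublists⁺ xs⊑ys)
  ∈-sublists⁺ {ys = y ∷ ys} (refl ∷ xs⊑ys) =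
    ∈-++⁺ʳ (sublists ys) (∈-map⁺ (y ∷_) (∈-sublists⁺ xs⊑ys))

  Unique-sublists : ∀ {ys : List A} → Unique ys → Unique (sublists ys)
  Unique-sublists [] = [] ∷ []
  Unique-sublists {y ∷ ys} !y∷ys@(_ ∷ !ys) =
    ++⁺ (Unique-sublists !ys) (Unique-map⁺ (λ _ _ → ∷-injectiveʳ) (Unique-sublists !ys)) disjoint
    where
    disjoint : ∀ {xs} → xs ∈ sublists ys × xs ∈ map (y ∷_) (sublists ys) → ⊥
    disjoint (xs∈ , y∷zs∈) with _ , _ , refl ← ∈-map⁻ (y ∷_) y∷zs∈ =
      Unique[x∷xs]⇒x∉xs !y∷ys (Any-resp-⊆ (∈-sublists⁻ xs∈) (here refl))

  filterᵇ≡filter : ∀ (p : A → Bool) xs → filterᵇ p xs ≡ filter (T? ∘ p) xs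
  filterᵇ≡filter p [] = refl
  filterᵇ≡filter p (x ∷ xs) with p x
  ... | true = cong (x ∷_) (filterᵇ≡filter p xs)
  ... | false = filterᵇ≡filter p xs

¬T⇒≡false : ∀ {b} → ¬ T b → b ≡ false
¬T⇒≡false = ¬-not ∘ (_∘ Equivalence.from T-≡)

module _ {A : Set} {p : A → A → Bool} where

  pairwiseᵇ⁻ : (∀ {x y} → T (p x y) → T (p y x)) → ∀ {xs} → T (pairwiseᵇ p xs) →
               ∀ {x y} → x ∈ xs → y ∈ xs → x ≢ y → T (p x y)
  pairwiseᵇ⁻ p-sym {z ∷ zs} pw (here refl) (here refl) x≢y = contradiction refl x≢y
  pairwiseᵇ⁻ p-sym {z ∷ zs} pw (here refl) (there y∈zs) _ =
    All.lookup (all⁺ (p z) zs (proj₁ (Equivalence.to T-∧ pw))) y∈zs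
  pairwiseᵇ⁻ p-sym {z ∷ zs} pw (there x∈zs) (here refl) _ =
    p-sym (All.lookup (all⁺ (p z) zs (proj₁ (Equivalence.to T-∧ pw))) x∈zs)
  pairwiseᵇ⁻ p-sym {z ∷ zs} pw (there x∈zs) (there y∈zs) =
    pairwiseᵇ⁻ p-sym (proj₂ (Equivalence.to T-∧ pw)) x∈zs y∈zs

  pairwiseᵇ⁺ : ∀ {xs} → Unique xs → (∀ {x y} → x ∈ xs → y ∈ xs → x ≢ y → T (p x y)) →
               T (pairwiseᵇ p xs)
  pairwiseᵇ⁺ [] _ = _
  pairwiseᵇ⁺ {z ∷ zs} (z∉zs ∷ !zs) pz = Equivalence.from T-∧
    ( all⁻ (p z) (All.tabulate λ y∈zs → pz (here refl) (there y∈zs) (All.lookup z∉zs y∈zs))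
    , pairwiseᵇ⁺ !zs λ x∈zs y∈zs → pz (there x∈zs) (there y∈zs))

-- Subsets of Fin n

lookup-≗⇒≡ : ∀ {a} {A : Set a} {n} {u v : Vec A n} → lookup u ≗ lookup v → u ≡ v
lookup-≗⇒≡ {u = u} {v} u≗v = begin
  u                   ≡⟨ Vec.tabulate∘lookup u ⟨
  tabulate (lookup u) ≡⟨ Vec.tabulate-cong u≗v ⟩
  tabulate (lookup v) ≡⟨ Vec.tabulate∘lookup v ⟩
  v                   ∎
  where open ≡-Reasoning

∣p∩q∣+2≤∣p∣ : ∀ {n} (p q : Subset n) {x y} → x ≢ y → x Sub.∈ p → y Sub.∈ p → x Sub.∉ q → y Sub.∉ q →
              2 + ∣ p ∩ q ∣ ≤ ∣ p ∣
∣p∩q∣+2≤∣p∣ p q {x} {y} x≢y x∈p y∈p x∉q y∉q = begin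
  2 + ∣ p ∩ q ∣     ≤⟨ s≤s (s≤s (p⊆q⇒∣p∣≤∣q∣ p∩q⊆p-x-y)) ⟩
  2 + ∣ p - x - y ∣ ≤⟨ s≤s (x∈p⇒∣p-x∣<∣p∣ (x∈p∧x≢y⇒x∈p-y y∈p (≢-sym x≢y))) ⟩
  1 + ∣ p - x ∣     ≤⟨ x∈p⇒∣p-x∣<∣p∣ x∈p ⟩
  ∣ p ∣             ∎
  where
  open ℕ.≤-Reasoning
  p∩q⊆p-x-y : p ∩ q Sub.⊆ p - x - y
  p∩q⊆p-x-y z∈p∩q with z∈p , z∈q ← x∈p∩q⁻ p q z∈p∩q =
    x∈p∧x≢y⇒x∈p-y (x∈p∧x≢y⇒x∈p-y z∈p λ { refl → x∉q z∈q }) λ { refl → y∉q z∈q }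

module _ {n : ℕ} {p : Subset n} {x : Fin n} where

  ∈ᵇ⇒∈ : x ∈ᵇ p ≡ true → x Sub.∈ p
  ∈ᵇ⇒∈ = Vec.lookup⇒[]= x p

  ∉ᵇ⇒∉ : x ∈ᵇ p ≡ false → x Sub.∉ p
  ∉ᵇ⇒∉ x∉p x∈p with () ← trans (sym (Vec.[]=⇒lookup x∈p)) x∉p

p─q-subsingleton : ∀ {n} (p q : Subset n) {x y} → ∣ p ∣ ≡ suc ∣ p ∩ q ∣ →
                   x ∈ᵇ p ≡ true → x ∈ᵇ q ≡ false → y ∈ᵇ p ≡ true → y ∈ᵇ q ≡ false → x ≡ y
p─q-subsingleton p q {x} {y} ∣p∣≡1+∣p∩q∣ x∈p x∉q y∈p y∉q with x ≟ y
... | yes x≡y = x≡y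
... | no x≢y = contradiction (subst (2 + ∣ p ∩ q ∣ ≤_) ∣p∣≡1+∣p∩q∣
                 (∣p∩q∣+2≤∣p∣ p q x≢y (∈ᵇ⇒∈ x∈p) (∈ᵇ⇒∈ y∈p) (∉ᵇ⇒∉ x∉q) (∉ᵇ⇒∉ y∉q))) ℕ.1+n≰n

∈ᵇ-─ : ∀ {n} (p q : Subset n) x → x ∈ᵇ (p ─ q) ≡ x ∈ᵇ p ∧ not (x ∈ᵇ q)
∈ᵇ-─ (b ∷ p) (true ∷ q) zero = sym (∧-zeroʳ b)
∈ᵇ-─ (b ∷ p) (false ∷ q) zero = sym (∧-identityʳ b)
∈ᵇ-─ (_ ∷ p) (_ ∷ q) (suc x) = ∈ᵇ-─ p q x

module _ {n : ℕ} (x : Fin n) where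

  ∈ᵇ-∪ : ∀ p q → x ∈ᵇ (p ∪ q) ≡ x ∈ᵇ p ∨ x ∈ᵇ q
  ∈ᵇ-∪ = Vec.lookup-zipWith _∨_ x

  x∈ᵇ⁅x⁆ : x ∈ᵇ ⁅ x ⁆ ≡ true
  x∈ᵇ⁅x⁆ = Vec.[]=⇒lookup (x∈⁅x⁆ x)

  x≢y⇒x∉ᵇ⁅y⁆ : ∀ {y} → x ≢ y → x ∈ᵇ ⁅ y ⁆ ≡ false
  x≢y⇒x∉ᵇ⁅y⁆ {y} x≢y = ¬-not (x≢y⇒x∉⁅y⁆ x≢y ∘ Vec.lookup⇒[]= x ⁅ y ⁆)

module _ {n : ℕ} where

  ∣∷∷∣-comm : ∀ b c (p : Subset n) → ∣ b ∷ c ∷ p ∣ ≡ ∣ c ∷ b ∷ p ∣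
  ∣∷∷∣-comm false false p = refl
  ∣∷∷∣-comm false true p = refl
  ∣∷∷∣-comm true false p = refl
  ∣∷∷∣-comm true true p = refl

  ∣∷∣-cong : ∀ c {p q : Subset n} → ∣ p ∣ ≡ ∣ q ∣ → ∣ c ∷ p ∣ ≡ ∣ c ∷ q ∣
  ∣∷∣-cong false = id
  ∣∷∣-cong true = cong suc

  ∣∷∣-cancel : ∀ c {p q : Subset n} → ∣ c ∷ p ∣ ≡ ∣ c ∷ q ∣ → ∣ p ∣ ≡ ∣ q ∣
  ∣∷∣-cancel false = id
  ∣∷∣-cancel true = ℕ.suc-injective

∣∷[]≔∣ : ∀ {n} (p : Subset n) x b → ∣ (x ∈ᵇ p) ∷ p [ x ]≔ b ∣ ≡ ∣ b ∷ p ∣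
∣∷[]≔∣ (c ∷ p) zero b = ∣∷∷∣-comm c b p
∣∷[]≔∣ (c ∷ p) (suc x) b = begin
  ∣ (x ∈ᵇ p) ∷ c ∷ p [ x ]≔ b ∣ ≡⟨ ∣∷∷∣-comm (x ∈ᵇ p) c (p [ x ]≔ b) ⟩
  ∣ c ∷ (x ∈ᵇ p) ∷ p [ x ]≔ b ∣ ≡⟨ ∣∷∣-cong c {(x ∈ᵇ p) ∷ p [ x ]≔ b} {b ∷ p} (∣∷[]≔∣ p x b) ⟩
  ∣ c ∷ b ∷ p ∣                 ≡⟨ ∣∷∷∣-comm c b p ⟩
  ∣ b ∷ c ∷ p ∣                 ∎
  where open ≡-Reasoning

∈-allSubsets : ∀ {n} (p : Subset n) → p ∈ allSubsets n
∈-allSubsets [] = here refl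
∈-allSubsets (false ∷ p) = ∈-++⁺ˡ (∈-map⁺ (false ∷_) (∈-allSubsets p))
∈-allSubsets (true ∷ p) = ∈-++⁺ʳ (map (false ∷_) (allSubsets _)) (∈-map⁺ (true ∷_) (∈-allSubsets p))

Unique-allSubsets : ∀ n → Unique (allSubsets n)
Unique-allSubsets zero = [] ∷ []
Unique-allSubsets (suc n) = ++⁺ (prepend false) (prepend true) disjoint
  where
  prepend : ∀ b → Unique (map (b ∷_) (allSubsets n))
  prepend b = Unique-map⁺ (λ _ _ → Vec.∷-injectiveʳ) (Unique-allSubsets n)
  disjoint : ∀ {p} → p ∈ map (false ∷_) (allSubsets n) × p ∈ map (true ∷_) (allSubsets n) → ⊥
  disjoint (p∈ , q∈) with _ , _ , refl ← ∈-map⁻ (false ∷_) p∈ | _ , _ , () ← ∈-map⁻ (true ∷_) q∈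

module _ {n : ℕ} where

  ==S⇒≡ : ∀ {p q : Subset n} → T (p ==S q) → p ≡ q
  ==S⇒≡ = toWitness

  ≡⇒==S : ∀ {p q : Subset n} → p ≡ q → T (p ==S q)
  ≡⇒==S = fromWitness

  Unique-edges : (G : Hypergraph n) → Unique (edges G)
  Unique-edges G rewrite filterᵇ≡filter G (allSubsets n) =
    Unique-filter⁺ (T? ∘ G) (Unique-allSubsets n)

  ∈-edges⁻ : ∀ {G : Hypergraph n} {e} → e ∈ edges G → T (G e)
  ∈-edges⁻ {G} e∈ rewrite filterᵇ≡filter G (allSubsets n) =
    proj₂ (∈-filter⁻ (T? ∘ G) {xs = allSubsets n} e∈)

  ∈-edges⁺ : ∀ {G : Hypergraph n} {e} → T (G e) → e ∈ edges G
  ∈-edges⁺ {G} {e} e∈G rewrite filterᵇ≡filter G (allSubsets n) =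
    ∈-filter⁺ (T? ∘ G) (∈-allSubsets e) e∈G

-- Sunflowers in a hypergraph

module _ {n : ℕ} where

  record IsSunflower (t : ℕ) (F : List (Subset n)) : Set where
    field
      kernel : Subset n
      ∣kernel∣ : ∣ kernel ∣ ≡ t
      petals-meet-in-kernel : ∀ {a b} → a ∈ F → b ∈ F → a ≢ b → a ∩ b ≡ kernel

  isSunflower⇒IsSunflower : ∀ {t F} → T (isSunflower t F) → IsSunflower t F
  isSunflower⇒IsSunflower {t} {F} sf with K , K-ok ← satisfied (any⁻ _ (allSubsets n) sf) = record
    { kernel = K
    ; ∣kernel∣ = ℕ.≡ᵇ⇒≡ ∣ K ∣ t (proj₁ (Equivalence.to T-∧ K-ok))
    ; petals-meet-in-kernel = λ a∈F b∈F a≢b →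
        ==S⇒≡ (pairwiseᵇ⁻ ∩-sym (proj₂ (Equivalence.to T-∧ K-ok)) a∈F b∈F a≢b)
    }
    where
    ∩-sym : ∀ {a b} → T ((a ∩ b) ==S K) → T ((b ∩ a) ==S K)
    ∩-sym {a} {b} = subst (λ c → T (c ==S K)) (∩-comm a b)

  IsSunflower⇒isSunflower : ∀ {t F} → Unique F → IsSunflower t F → T (isSunflower t F)
  IsSunflower⇒isSunflower {t} {F} !F sf = any⁺ _ (lose (∈-allSubsets kernel)
    (Equivalence.from T-∧ (ℕ.≡⇒≡ᵇ ∣ kernel ∣ t ∣kernel∣ ,
      pairwiseᵇ⁺ !F λ a∈F b∈F a≢b → ≡⇒==S (petals-meet-in-kernel a∈F b∈F a≢b))))
    where open IsSunflower sf

  IsSunflower-⊆ : ∀ {t F G} → F ⊆ G → IsSunflower t G → IsSunflower t F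
  IsSunflower-⊆ F⊆G sf = record
    { kernel = kernel
    ; ∣kernel∣ = ∣kernel∣
    ; petals-meet-in-kernel = λ a∈F b∈F → petals-meet-in-kernel (F⊆G a∈F) (F⊆G b∈F)
    }
    where open IsSunflower sf

  record SunflowerFamily (t k : ℕ) (G : Hypergraph n) (F : List (Subset n)) : Set where
    field
      unique : Unique F
      petals∈G : ∀ {e} → e ∈ F → T (G e)
      length≡k : length F ≡ k
      sunflower : IsSunflower t F

  sunflowers : ℕ → ℕ → Hypergraph n → List (List (Subset n))
  sunflowers t k G = filterᵇ (λ F → (length F ≡ᵇ k) ∧ isSunflower t F) (sublists (edges G))

  open DecMembership (Vec.≡-dec {n = n} Bool._≟_) using (_∈?_)

  module _ (G : Hypergraph n) where

    -- Counted families are sublists of edges G, so M is listed again in the order of edges G.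
    restrict : List (Subset n) → List (Subset n)
    restrict M = filter (_∈? M) (edges G)

    restrict-⊆ : ∀ M → restrict M ⊆ M
    restrict-⊆ M = proj₂ ∘ ∈-filter⁻ (_∈? M) {xs = edges G}

    ⊆-restrict : ∀ {M} → (∀ {e} → e ∈ M → T (G e)) → M ⊆ restrict M
    ⊆-restrict {M} M⊆G e∈M = ∈-filter⁺ (_∈? M) (∈-edges⁺ (M⊆G e∈M)) e∈M

  module _ {t k : ℕ} {G : Hypergraph n} where

    private
      Counted : List (Subset n) → Bool
      Counted F = (length F ≡ᵇ k) ∧ isSunflower t F

      sunflowers≡filter : sunflowers t k G ≡ filter (T? ∘ Counted) (sublists (edges G))
      sunflowers≡filter = filterᵇ≡filter Counted (sublists (edges G))

    Unique-sunflowers : Unique (sunflowers t k G)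
    Unique-sunflowers rewrite sunflowers≡filter =
      Unique-filter⁺ (T? ∘ Counted) (Unique-sublists (Unique-edges G))

    ∈-sunflowers⁻ : ∀ {F} → F ∈ sunflowers t k G → F ⊑ edges G × SunflowerFamily t k G F
    ∈-sunflowers⁻ {F} F∈ rewrite sunflowers≡filter
      with F∈sublists , counted ← ∈-filter⁻ (T? ∘ Counted) {xs = sublists (edges G)} F∈ =
      F⊑G , record
        { unique = Unique-resp-⊑ F⊑G (Unique-edges G)
        ; petals∈G = ∈-edges⁻ ∘ Any-resp-⊆ F⊑G
        ; length≡k = ℕ.≡ᵇ⇒≡ (length F) k (proj₁ (Equivalence.to T-∧ counted))
        ; sunflower = isSunflower⇒IsSunflower (proj₂ (Equivalence.to T-∧ counted))
        }
      where
      F⊑G : F ⊑ edges G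
      F⊑G = ∈-sublists⁻ F∈sublists

    ∈-sunflowers-ext : ∀ {F₁ F₂} → F₁ ∈ sunflowers t k G → F₂ ∈ sunflowers t k G →
                       F₁ ⊆ F₂ → F₂ ⊆ F₁ → F₁ ≡ F₂
    ∈-sunflowers-ext F₁∈ F₂∈ =
      ⊑-ext (Unique-edges G) (proj₁ (∈-sunflowers⁻ F₁∈)) (proj₁ (∈-sunflowers⁻ F₂∈))

    restrict-∈-sunflowers : ∀ {M} → SunflowerFamily t k G M → restrict G M ∈ sunflowers t k G
    restrict-∈-sunflowers {M} family rewrite sunflowers≡filter =
      ∈-filter⁺ (T? ∘ Counted) (∈-sublists⁺ (filter-⊆ (_∈? M) (edges G))) (Equivalence.from T-∧
        ( ℕ.≡⇒≡ᵇ _ k (trans same-length length≡k)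
        , IsSunflower⇒isSunflower !restrict (IsSunflower-⊆ (restrict-⊆ G M) sunflower)))
      where
      open SunflowerFamily family
      !restrict : Unique (restrict G M)
      !restrict = Unique-filter⁺ (_∈? M) (Unique-edges G)
      same-length : length (restrict G M) ≡ length M
      same-length = length-cong-⊆⊇ !restrict unique (restrict-⊆ G M) (⊆-restrict G petals∈G)

-- Exchanging two vertices

module Transposition {n : ℕ} (i j : Fin n) (i≢j : i ≢ j) where

  σ : Subset n → Subset n
  σ p = (p [ i ]≔ (j ∈ᵇ p)) [ j ]≔ (i ∈ᵇ p)

  i∈ᵇσ : ∀ p → i ∈ᵇ σ p ≡ j ∈ᵇ p
  i∈ᵇσ p =
    trans (Vec.lookup∘update′ i≢j (p [ i ]≔ (j ∈ᵇ p)) (i ∈ᵇ p)) (Vec.lookup∘update i p (j ∈ᵇ p))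

  j∈ᵇσ : ∀ p → j ∈ᵇ σ p ≡ i ∈ᵇ p
  j∈ᵇσ p = Vec.lookup∘update j (p [ i ]≔ (j ∈ᵇ p)) (i ∈ᵇ p)

  x∈ᵇσ : ∀ {x} p → x ≢ i → x ≢ j → x ∈ᵇ σ p ≡ x ∈ᵇ p
  x∈ᵇσ p x≢i x≢j =
    trans (Vec.lookup∘update′ x≢j (p [ i ]≔ (j ∈ᵇ p)) (i ∈ᵇ p)) (Vec.lookup∘update′ x≢i p (j ∈ᵇ p))

  ≡-by-position : ∀ {p q : Subset n} → i ∈ᵇ p ≡ i ∈ᵇ q → j ∈ᵇ p ≡ j ∈ᵇ q →
                  (∀ {x} → x ≢ i → x ≢ j → x ∈ᵇ p ≡ x ∈ᵇ q) → p ≡ q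
  ≡-by-position {p} {q} at-i at-j elsewhere = lookup-≗⇒≡ λ x → by-position x
    where
    by-position : ∀ x → x ∈ᵇ p ≡ x ∈ᵇ q
    by-position x with x ≟ i | x ≟ j
    ... | yes refl | _ = at-i
    ... | no _ | yes refl = at-j
    ... | no x≢i | no x≢j = elsewhere x≢i x≢j

  data Trace (p : Subset n) : Set where
    neither : i ∈ᵇ p ≡ false → j ∈ᵇ p ≡ false → Trace p
    both    : i ∈ᵇ p ≡ true  → j ∈ᵇ p ≡ true  → Trace p
    i-only  : i ∈ᵇ p ≡ true  → j ∈ᵇ p ≡ false → Trace p
    j-only  : i ∈ᵇ p ≡ false → j ∈ᵇ p ≡ true  → Trace p

  trace : ∀ p → Trace p
  trace p with i ∈ᵇ p in i∈p | j ∈ᵇ p in j∈p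
  ... | false | false = neither i∈p j∈p
  ... | true  | true  = both i∈p j∈p
  ... | true  | false = i-only i∈p j∈p
  ... | false | true  = j-only i∈p j∈p

  σ-involutive : ∀ p → σ (σ p) ≡ p
  σ-involutive p = ≡-by-position
    (trans (i∈ᵇσ (σ p)) (j∈ᵇσ p))
    (trans (j∈ᵇσ (σ p)) (i∈ᵇσ p))
    (λ x≢i x≢j → trans (x∈ᵇσ (σ p) x≢i x≢j) (x∈ᵇσ p x≢i x≢j))

  σ-injective : ∀ {p q} → σ p ≡ σ q → p ≡ q
  σ-injective {p} {q} σp≡σq = begin
    p         ≡⟨ σ-involutive p ⟨
    σ (σ p)   ≡⟨ cong σ σp≡σq ⟩
    σ (σ q)   ≡⟨ σ-involutive q ⟩
    q         ∎
    where open ≡-Reasoning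

  σ-∩ : ∀ p q → σ (p ∩ q) ≡ σ p ∩ σ q
  σ-∩ p q = ≡-by-position
    (pointwise (i∈ᵇσ (p ∩ q)) (i∈ᵇσ p) (i∈ᵇσ q))
    (pointwise (j∈ᵇσ (p ∩ q)) (j∈ᵇσ p) (j∈ᵇσ q))
    (λ x≢i x≢j → pointwise (x∈ᵇσ (p ∩ q) x≢i x≢j) (x∈ᵇσ p x≢i x≢j) (x∈ᵇσ q x≢i x≢j))
    where
    pointwise : ∀ {x y} → x ∈ᵇ σ (p ∩ q) ≡ y ∈ᵇ (p ∩ q) → x ∈ᵇ σ p ≡ y ∈ᵇ p → x ∈ᵇ σ q ≡ y ∈ᵇ q →
                x ∈ᵇ σ (p ∩ q) ≡ x ∈ᵇ (σ p ∩ σ q)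
    pointwise {x} {y} σ∩ σp σq = begin
      x ∈ᵇ σ (p ∩ q)          ≡⟨ σ∩ ⟩
      y ∈ᵇ (p ∩ q)            ≡⟨ Vec.lookup-zipWith _∧_ y p q ⟩
      y ∈ᵇ p ∧ y ∈ᵇ q         ≡⟨ cong₂ _∧_ σp σq ⟨
      x ∈ᵇ σ p ∧ x ∈ᵇ σ q     ≡⟨ Vec.lookup-zipWith _∧_ x (σ p) (σ q) ⟨
      x ∈ᵇ (σ p ∩ σ q)        ∎
      where open ≡-Reasoning

  ∣σ∣ : ∀ p → ∣ σ p ∣ ≡ ∣ p ∣
  ∣σ∣ p = ∣∷∣-cancel (j ∈ᵇ p) {σ p} {p} (begin
    ∣ (j ∈ᵇ p) ∷ σ p ∣                 ≡⟨ cong (λ c → ∣ c ∷ σ p ∣) j∈p′ ⟨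
    ∣ (j ∈ᵇ p′) ∷ p′ [ j ]≔ (i ∈ᵇ p) ∣ ≡⟨ ∣∷[]≔∣ p′ j (i ∈ᵇ p) ⟩
    ∣ (i ∈ᵇ p) ∷ p′ ∣                  ≡⟨ ∣∷[]≔∣ p i (j ∈ᵇ p) ⟩
    ∣ (j ∈ᵇ p) ∷ p ∣                   ∎)
    where
    open ≡-Reasoning
    p′ : Subset n
    p′ = p [ i ]≔ (j ∈ᵇ p)
    j∈p′ : j ∈ᵇ p′ ≡ j ∈ᵇ p
    j∈p′ = Vec.lookup∘update′ (≢-sym i≢j) p (j ∈ᵇ p)

  σ-fixes : ∀ {p} → i ∈ᵇ p ≡ j ∈ᵇ p → σ p ≡ p
  σ-fixes {p} i∼j = ≡-by-position (trans (i∈ᵇσ p) (sym i∼j)) (trans (j∈ᵇσ p) i∼j) (x∈ᵇσ p)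

  σ-moves : ∀ {p} → j ∈ᵇ p ≡ true → i ∈ᵇ p ≡ false → (p - j) ∪ ⁅ i ⁆ ≡ σ p
  σ-moves {p} j∈p i∉p = ≡-by-position at-i at-j elsewhere
    where
    at-i : i ∈ᵇ ((p - j) ∪ ⁅ i ⁆) ≡ i ∈ᵇ σ p
    at-i rewrite ∈ᵇ-∪ i (p - j) ⁅ i ⁆ | x∈ᵇ⁅x⁆ i | i∈ᵇσ p | j∈p = ∨-zeroʳ _
    at-j : j ∈ᵇ ((p - j) ∪ ⁅ i ⁆) ≡ j ∈ᵇ σ p
    at-j rewrite ∈ᵇ-∪ j (p - j) ⁅ i ⁆ | ∈ᵇ-─ p ⁅ j ⁆ j | x∈ᵇ⁅x⁆ j | x≢y⇒x∉ᵇ⁅y⁆ j (≢-sym i≢j)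
               | j∈ᵇσ p | i∉p = trans (∨-identityʳ _) (∧-zeroʳ _)
    elsewhere : ∀ {x} → x ≢ i → x ≢ j → x ∈ᵇ ((p - j) ∪ ⁅ i ⁆) ≡ x ∈ᵇ σ p
    elsewhere {x} x≢i x≢j rewrite ∈ᵇ-∪ x (p - j) ⁅ i ⁆ | ∈ᵇ-─ p ⁅ j ⁆ x | x≢y⇒x∉ᵇ⁅y⁆ x x≢i
                                | x≢y⇒x∉ᵇ⁅y⁆ x x≢j | x∈ᵇσ p x≢i x≢j =
      trans (∨-identityʳ _) (∧-identityʳ _)

  σ-adjacent : ∀ {p q} → ∣ p ∣ ≡ suc ∣ p ∩ q ∣ → ∣ q ∣ ≡ suc ∣ q ∩ p ∣ →
               i ∈ᵇ p ≡ true → i ∈ᵇ q ≡ false → j ∈ᵇ q ≡ true → j ∈ᵇ p ≡ false → σ p ≡ q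
  σ-adjacent {p} {q} ∣p∣≡1+∣p∩q∣ ∣q∣≡1+∣q∩p∣ i∈p i∉q j∈q j∉p = ≡-by-position
    (trans (i∈ᵇσ p) (trans j∉p (sym i∉q)))
    (trans (j∈ᵇσ p) (trans i∈p (sym j∈q)))
    (λ x≢i x≢j → trans (x∈ᵇσ p x≢i x≢j) (agree x≢i x≢j))
    where
    agree : ∀ {x} → x ≢ i → x ≢ j → x ∈ᵇ p ≡ x ∈ᵇ q
    agree {x} x≢i x≢j with x ∈ᵇ p in x∈p | x ∈ᵇ q in x∈q
    ... | false | false = refl
    ... | true | true = refl
    ... | true | false = contradiction (p─q-subsingleton p q ∣p∣≡1+∣p∩q∣ x∈p x∈q i∈p i∉q) x≢i
    ... | false | true = contradiction (p─q-subsingleton q p ∣q∣≡1+∣q∩p∣ x∈q x∈p j∈q j∉p) x≢j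

  IsSunflower-map-σ : ∀ {t F} → IsSunflower t F → IsSunflower t (map σ F)
  IsSunflower-map-σ {F = F} sf = record
    { kernel = σ kernel
    ; ∣kernel∣ = trans (∣σ∣ kernel) ∣kernel∣
    ; petals-meet-in-kernel = meet
    }
    where
    open IsSunflower sf
    meet : ∀ {a b} → a ∈ map σ F → b ∈ map σ F → a ≢ b → a ∩ b ≡ σ kernel
    meet a∈σF b∈σF a≢b with a , a∈F , refl ← ∈-map⁻ σ a∈σF | b , b∈F , refl ← ∈-map⁻ σ b∈σF =
      trans (sym (σ-∩ a b)) (cong σ (petals-meet-in-kernel a∈F b∈F (a≢b ∘ cong σ)))

-- The shifting operator

module Shifting {n : ℕ} (H : Hypergraph n) (i j : Fin n) (i≢j : i ≢ j) where
  open Transposition i j i≢j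

  shiftEdge-∈-shift : ∀ {e} → T (H e) → T (shift i j H (shiftEdge H i j e))
  shiftEdge-∈-shift {e} e∈H =
    any⁺ _ (lose (∈-allSubsets e) (Equivalence.from T-∧ (e∈H , ≡⇒==S refl)))

  shiftCondition : Subset n → Bool
  shiftCondition e = (j ∈ᵇ e) ∧ not (i ∈ᵇ e) ∧ not (H ((e - j) ∪ ⁅ i ⁆))

  shiftEdge-if : ∀ {e c} → shiftCondition e ≡ c →
                 shiftEdge H i j e ≡ (if c then (e - j) ∪ ⁅ i ⁆ else e)
  shiftEdge-if {e} = cong (λ c → if c then (e - j) ∪ ⁅ i ⁆ else e)

  shiftCondition-σ : ∀ {e} → j ∈ᵇ e ≡ true → i ∈ᵇ e ≡ false → shiftCondition e ≡ not (H (σ e))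
  shiftCondition-σ {e} j∈e i∉e = trans
    (cong₂ (λ a b → a ∧ not b ∧ not (H ((e - j) ∪ ⁅ i ⁆))) j∈e i∉e)
    (cong (not ∘ H) (σ-moves j∈e i∉e))

  shiftEdge-stays-j∉ : ∀ {e} → j ∈ᵇ e ≡ false → shiftEdge H i j e ≡ e
  shiftEdge-stays-j∉ {e} j∉e =
    shiftEdge-if (cong (_∧ not (i ∈ᵇ e) ∧ not (H ((e - j) ∪ ⁅ i ⁆))) j∉e)

  shiftEdge-stays-i∈ : ∀ {e} → j ∈ᵇ e ≡ true → i ∈ᵇ e ≡ true → shiftEdge H i j e ≡ e
  shiftEdge-stays-i∈ {e} j∈e i∈e =
    shiftEdge-if (cong₂ (λ a b → a ∧ not b ∧ not (H ((e - j) ∪ ⁅ i ⁆))) j∈e i∈e)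

  shiftEdge-stays-σ∈ : ∀ {e} → j ∈ᵇ e ≡ true → i ∈ᵇ e ≡ false → T (H (σ e)) → shiftEdge H i j e ≡ e
  shiftEdge-stays-σ∈ j∈e i∉e σe∈H =
    shiftEdge-if (trans (shiftCondition-σ j∈e i∉e) (cong not (Equivalence.to T-≡ σe∈H)))

  shiftEdge-moves : ∀ {e} → j ∈ᵇ e ≡ true → i ∈ᵇ e ≡ false → ¬ T (H (σ e)) → shiftEdge H i j e ≡ σ e
  shiftEdge-moves j∈e i∉e σe∉H = trans
    (shiftEdge-if (trans (shiftCondition-σ j∈e i∉e) (cong not (¬T⇒≡false σe∉H))))
    (σ-moves j∈e i∉e)

  ∈-shift-if-stays : ∀ {e} → T (H e) → shiftEdge H i j e ≡ e → T (shift i j H e)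
  ∈-shift-if-stays e∈H stays = subst (T ∘ shift i j H) stays (shiftEdge-∈-shift e∈H)

  σ-∈-shift : ∀ {e} → T (H e) → (i ∈ᵇ e ≡ true → j ∈ᵇ e ≡ false → T (H (σ e))) →
              T (shift i j H (σ e))
  σ-∈-shift {e} e∈H σe∈H-if-i-only with trace e
  ... | neither i∉e j∉e = subst (T ∘ shift i j H) (sym (σ-fixes (trans i∉e (sym j∉e))))
                            (∈-shift-if-stays e∈H (shiftEdge-stays-j∉ j∉e))
  ... | both i∈e j∈e = subst (T ∘ shift i j H) (sym (σ-fixes (trans i∈e (sym j∈e))))
                         (∈-shift-if-stays e∈H (shiftEdge-stays-i∈ j∈e i∈e))
  ... | i-only i∈e j∉e = ∈-shift-if-stays (σe∈H-if-i-only i∈e j∉e)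
        (shiftEdge-stays-σ∈ (trans (j∈ᵇσ e) i∈e) (trans (i∈ᵇσ e) j∉e)
                            (subst (T ∘ H) (sym (σ-involutive e)) e∈H))
  ... | j-only i∉e j∈e with T? (H (σ e))
  ...   | yes σe∈H = ∈-shift-if-stays σe∈H (shiftEdge-stays-j∉ (trans (j∈ᵇσ e) i∉e))
  ...   | no σe∉H = subst (T ∘ shift i j H) (shiftEdge-moves j∈e i∉e σe∉H) (shiftEdge-∈-shift e∈H)

  ∉-shift⇒moves : ∀ {e} → T (H e) → ¬ T (shift i j H e) →
                  i ∈ᵇ e ≡ false × j ∈ᵇ e ≡ true × ¬ T (H (σ e))
  ∉-shift⇒moves {e} e∈H e∉S with trace e
  ... | neither _ j∉e = contradiction (∈-shift-if-stays e∈H (shiftEdge-stays-j∉ j∉e)) e∉S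
  ... | both i∈e j∈e = contradiction (∈-shift-if-stays e∈H (shiftEdge-stays-i∈ j∈e i∈e)) e∉S
  ... | i-only _ j∉e = contradiction (∈-shift-if-stays e∈H (shiftEdge-stays-j∉ j∉e)) e∉S
  ... | j-only i∉e j∈e with T? (H (σ e))
  ...   | yes σe∈H = contradiction (∈-shift-if-stays e∈H (shiftEdge-stays-σ∈ j∈e i∉e σe∈H)) e∉S
  ...   | no σe∉H = i∉e , j∈e , σe∉H

module Injection {n : ℕ} (t k : ℕ) (H : Hypergraph n) (uniform : Uniform (suc t) H)
                 (i j : Fin n) (i≢j : i ≢ j) where
  open Transposition i j i≢j
  open Shifting H i j i≢j

  S : Hypergraph n
  S = shift i j H

  module Petals {F} (F∈ : F ∈ sunflowers t k H) where
    open SunflowerFamily (proj₂ (∈-sunflowers⁻ F∈)) public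
    open IsSunflower sunflower

    ∣a∣≡1+∣a∩b∣ : ∀ {a b} → a ∈ F → b ∈ F → a ≢ b → ∣ a ∣ ≡ suc ∣ a ∩ b ∣
    ∣a∣≡1+∣a∩b∣ a∈F b∈F a≢b = trans (uniform _ (Equivalence.to T-≡ (petals∈G a∈F)))
      (cong suc (sym (trans (cong ∣_∣ (petals-meet-in-kernel a∈F b∈F a≢b)) ∣kernel∣)))

    adjacent : ∀ {a b} → a ∈ F → b ∈ F →
               i ∈ᵇ a ≡ true → i ∈ᵇ b ≡ false → j ∈ᵇ b ≡ true → j ∈ᵇ a ≡ false → σ a ≡ b
    adjacent {a} {b} a∈F b∈F i∈a i∉b j∈b j∉a =
      σ-adjacent (∣a∣≡1+∣a∩b∣ a∈F b∈F a≢b) (∣a∣≡1+∣a∩b∣ b∈F a∈F (≢-sym a≢b)) i∈a i∉b j∈b j∉a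
      where
      a≢b : a ≢ b
      a≢b refl with () ← trans (sym i∈a) i∉b

    module _ {e₀} (e₀∈F : e₀ ∈ F) (e₀∉S : ¬ T (S e₀)) where

      σ-petal-∈-shift : ∀ {e} → e ∈ F → T (S (σ e))
      σ-petal-∈-shift e∈F with i∉e₀ , j∈e₀ , _ ← ∉-shift⇒moves (petals∈G e₀∈F) e₀∉S =
        σ-∈-shift (petals∈G e∈F) λ i∈e j∉e →
          subst (T ∘ H) (sym (adjacent e∈F e₀∈F i∈e i∉e₀ j∈e₀ j∉e)) (petals∈G e₀∈F)

      map-σ-family : SunflowerFamily t k S (map σ F)
      map-σ-family = record
        { unique = Unique-map⁺ (λ _ _ → σ-injective) unique
        ; petals∈G = σ-petals∈S
        ; length≡k = trans (length-map σ F) length≡k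
        ; sunflower = IsSunflower-map-σ sunflower
        }
        where
        σ-petals∈S : ∀ {e} → e ∈ map σ F → T (S e)
        σ-petals∈S e∈σF with _ , e∈F , refl ← ∈-map⁻ σ e∈σF = σ-petal-∈-shift e∈F

  shiftedPetals : List (Subset n) → List (Subset n)
  shiftedPetals F with all? (T? ∘ S) F
  ... | yes _ = F
  ... | no _ = map σ F

  shiftedPetals-family : ∀ {F} → F ∈ sunflowers t k H → SunflowerFamily t k S (shiftedPetals F)
  shiftedPetals-family {F} F∈ with all? (T? ∘ S) F
  ... | yes F⊆S = record { SunflowerFamily (proj₂ (∈-sunflowers⁻ F∈)) ; petals∈G = All.lookup F⊆S }
  ... | no F⊈S with _ , e₀∈F , e₀∉S ← find (¬All⇒Any¬ (T? ∘ S) F F⊈S) =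
    Petals.map-σ-family F∈ e₀∈F e₀∉S

  map-σ-⊈-sunflower : ∀ {F F′} → F ∈ sunflowers t k H → F′ ∈ sunflowers t k H →
                      ¬ All (T ∘ S) F → ¬ (map σ F ⊆ F′)
  map-σ-⊈-sunflower {F} F∈ F′∈ F⊈S σF⊆F′
    with _ , e₀∈F , e₀∉S ← find (¬All⇒Any¬ (T? ∘ S) F F⊈S) =
    proj₂ (proj₂ (∉-shift⇒moves (Petals.petals∈G F∈ e₀∈F) e₀∉S))
          (Petals.petals∈G F′∈ (σF⊆F′ (∈-map⁺ σ e₀∈F)))

  shiftedPetals-injective : ∀ {F₁ F₂} → F₁ ∈ sunflowers t k H → F₂ ∈ sunflowers t k H →
                            shiftedPetals F₁ ⊆ shiftedPetals F₂ →
                            shiftedPetals F₂ ⊆ shiftedPetals F₁ → F₁ ≡ F₂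
  shiftedPetals-injective {F₁} {F₂} F₁∈ F₂∈ with all? (T? ∘ S) F₁ | all? (T? ∘ S) F₂
  ... | yes _ | yes _ = ∈-sunflowers-ext F₁∈ F₂∈
  ... | no _ | no _ = λ σF₁⊆σF₂ σF₂⊆σF₁ →
    ∈-sunflowers-ext F₁∈ F₂∈ (map-⊆⁻ σ-injective σF₁⊆σF₂) (map-⊆⁻ σ-injective σF₂⊆σF₁)
  ... | yes _ | no F₂⊈S = λ _ σF₂⊆F₁ → ⊥-elim (map-σ-⊈-sunflower F₂∈ F₁∈ F₂⊈S σF₂⊆F₁)
  ... | no F₁⊈S | yes _ = λ σF₁⊆F₂ _ → ⊥-elim (map-σ-⊈-sunflower F₁∈ F₂∈ F₁⊈S σF₁⊆F₂)

  shiftSunflower : List (Subset n) → List (Subset n)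
  shiftSunflower F = restrict S (shiftedPetals F)

  shiftSunflower-injective : ∀ {F₁ F₂} → F₁ ∈ sunflowers t k H → F₂ ∈ sunflowers t k H →
                             shiftSunflower F₁ ≡ shiftSunflower F₂ → F₁ ≡ F₂
  shiftSunflower-injective {F₁} {F₂} F₁∈ F₂∈ eq =
    shiftedPetals-injective F₁∈ F₂∈ (⊆-of-≡ {F′ = F₂} F₁∈ eq) (⊆-of-≡ {F′ = F₁} F₂∈ (sym eq))
    where
    ⊆-of-≡ : ∀ {F F′} → F ∈ sunflowers t k H → shiftSunflower F ≡ shiftSunflower F′ →
             shiftedPetals F ⊆ shiftedPetals F′
    ⊆-of-≡ {F′ = F′} F∈ eq′ =
      restrict-⊆ S (shiftedPetals F′) ∘ subst (_ ∈_) eq′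
      ∘ ⊆-restrict S (SunflowerFamily.petals∈G (shiftedPetals-family F∈))

  N-S-≤-shift : N-S t k H ≤ N-S t k S
  N-S-≤-shift =
    length-≤-of-injection Unique-sunflowers shiftSunflower-injective
      (restrict-∈-sunflowers ∘ shiftedPetals-family)

lemma2p4 : (n r k : ℕ) → 1 ≤ r → 1 ≤ k → (H : Hypergraph n) → Uniform r H →
    (i j : Fin n) → i < j →
    N-S (r ∸ 1) k (shift i j H) ≥ N-S (r ∸ 1) k H
lemma2p4 n (suc t) k _ _ H uniform i j i<j = Injection.N-S-≤-shift t k H uniform i j (<⇒≢ i<j)
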